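{- Let $p$ be a prime and $r\ge2$ an integer. Consider all data consisting of an integer $s\ge1$, integers $r=r_1>r_2>\cdots>r_s>r_{s+1}\ge0$, and integers $j_1>j_2>\cdots>j_s\ge1$ none of which is divisible by $p$; put $u:=r-r_{s+1}$ and \[ \alpha(s,j_\bullet,r_\bullet):=\frac{1+\sum_{i=1}^{s}(r_i-r_{i+1})j_i-\sum_{i=1}^{s}(r_i-r_{i+1})\left\lfloor \frac{j_i}{p}\right\rfloor}{\sum_{i=1}^{s}(j_i+1)(p^{r_i}-p^{r_{i+1}})}. \] (1) Among data with $u\ge2$, $\alpha(s,j_\bullet,r_\bullet)$ has maximum value $\frac{1+r(p-1)}{p(p^r-1)}$, and this maximum is attained exactly when $u=r$, $s=1$ and $j_1=p-1$. (2) Among data with $u=1$ (so that $s=1$), $\alpha(s,j_\bullet,r_\bullet)$ has maximum value $\frac{1}{p^r-p^{r-1}}$, and this maximum is attained exactly when $j_1\in\{1,2,\dots,p-1\}$. -}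

module Defs where

open import Data.Nat as ℕ using (ℕ; zero; suc; _+_; _*_; _∸_; _^_; _<_)
open import Data.Nat.Divisibility using (_∣_)
open import Data.Nat.Primality using (Prime; prime⇒nonZero)
import Data.Nat.DivMod as DM
open import Data.Fin using (Fin; zero; suc; inject₁; fromℕ)
import Data.Fin as F
open import Data.Integer as ℤ using (ℤ; +_)
open import Data.Rational as ℚ using (ℚ; 0ℚ)
open import Relation.Nullary using (¬_)
open import Relation.Binary.PropositionalEquality using () renaming (_≡_ to _≡′_)

Σ : (n : ℕ) → (Fin n → ℕ) → ℕ
Σ zero    f = 0
Σ (suc n) f = f zero + Σ n (λ i → f (suc i))

⌊_/_⌋ : ℕ → (p : ℕ) → Prime p → ℕ
⌊ j / p ⌋ pp = DM._/_ j p {{prime⇒nonZero pp}}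

-- the fraction a / d in ℚ (convention: value 0 if d = 0; never used with d = 0)
frac : ℤ → ℕ → ℚ
frac a zero    = 0ℚ
frac a (suc d) = a ℚ./ suc d

-- The data (s, j•, r•) for a prime p and integer r.
-- s = suc t (so s ≥ 1).  rs i  is r_{i+1} for i = 0..s, js i is j_{i+1} for i = 0..s-1.
record Datum (p r : ℕ) (pp : Prime p) : Set where
  field
    t      : ℕ
    rs     : Fin (suc (suc t)) → ℕ
    js     : Fin (suc t) → ℕ
    rs-top : rs zero ≡′ r
    rs-dec : (i : Fin (suc t)) → rs (suc i) < rs (inject₁ i)
    js-dec : (i k : Fin (suc t)) → i F.< k → js k < js i
    js-pos : (i : Fin (suc t)) → 1 ℕ.≤ js i
    js-ndv : (i : Fin (suc t)) → ¬ (p ∣ js i)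
  s : ℕ
  s = suc t
  rlast : ℕ
  rlast = rs (fromℕ (suc t))
  u : ℕ
  u = r ∸ rlast
  δ : Fin (suc t) → ℕ
  δ i = rs (inject₁ i) ∸ rs (suc i)
  numer : ℤ
  numer = + 1 ℤ.+ + Σ s (λ i → δ i * js i) ℤ.- + Σ s (λ i → δ i * ⌊ js i / p ⌋ pp)
  denom : ℕ
  denom = Σ s (λ i → (js i + 1) * (p ^ rs (inject₁ i) ∸ p ^ rs (suc i)))
  α : ℚ
  α = frac numer denom

{-# OPTIONS --safe #-}
module Submission where

-- Put q = p − 1, Q = p ^ r − 1, K = 1 + r q and M = p Q, so that the bound in (1) is K / M.
-- Cross-multiplied, α ≤ K / M says M (1 + Σ δᵢ jᵢ) ≤ K D + M Σ δᵢ ⌊jᵢ / p⌋, where δᵢ = rᵢ − rᵢ₊₁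
-- and D is the denominator of α. With gap b = K (p ^ r − p ^ b) − q Q (r − b), the step from rᵢ
-- down to rᵢ₊₁ contributes exactly (jᵢ + 1)(gap rᵢ₊₁ − gap rᵢ) + Q δᵢ (q − jᵢ mod p) to the
-- difference of the two sides. Now gap r = 0, gap b > 0 below r, and Bernoulli's inequality gives
-- gap b ≥ Q for b ≤ r − 2 (this is where u ≥ 2 enters), with equality only at b = 0. Since the
-- weights jᵢ + 1 decrease, Abel summation bounds the difference below by
-- (jₛ + 1) gap rₛ₊₁ + Q δₛ (q − jₛ mod p) − M, strictly if s ≥ 2. As (j + 1) + (q − j mod p)
-- = p (1 + ⌊j / p⌋), this equals M ⌊jₛ / p⌋ + (jₛ + 1)(gap rₛ₊₁ − Q) + Q (δₛ − 1)(q − jₛ mod p),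
-- which vanishes only for rₛ₊₁ = 0 and jₛ = p − 1. When u = 1 there is a single step of height
-- one, and α = (1 + j − ⌊j / p⌋) / ((j + 1)(p ^ r − p ^ (r − 1))) is at most 1 / (p ^ r − p ^ (r − 1)),
-- with equality iff ⌊j / p⌋ = 0.

open import Defs
open import Data.Nat
  using (ℕ; zero; suc; _+_; _*_; _∸_; _^_; _≤_; _<_; z≤n; s≤s; z<s; s≤s⁻¹; NonZero; >-nonZero; nonTrivial⇒n>1)
open import Data.Nat.Properties
open import Data.Nat.DivMod using (_/_; _%_; m≡m%n+[m/n]*n; m%n<n; m<n⇒m/n≡0; m/n≡0⇒m<n)
open import Data.Nat.Divisibility using (>⇒∤)
open import Data.Nat.Primality using (Prime; prime⇒nonZero; prime⇒nonTrivial; ¬prime[0]; ¬prime[1])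
open import Data.Nat.Tactic.RingSolver using (solve-∀)
open import Data.Integer as ℤ using (+_; +≤+)
import Data.Integer.Properties as ℤP
import Data.Integer.Tactic.RingSolver as ℤRing
open import Data.Rational using () renaming (_≤_ to _≤ℚ_)
import Data.Rational.Properties as ℚP
import Data.Rational.Unnormalised as ℚᵘ
import Data.Rational.Unnormalised.Properties as ℚᵘP
open import Data.Fin using (Fin; zero; suc; inject₁; fromℕ)
open import Data.Product using (∃; _,_; _×_; proj₁; proj₂)
open import Data.Empty using (⊥-elim)
open import Function using (_∘_)
open import Function.Bundles using (_⇔_; mk⇔; Equivalence)
open import Relation.Binary.PropositionalEquality
open import Relation.Nullary using (contradiction)

frac-≤-frac : ∀ a b {d e} → 0 < d → 0 < e → a ℤ.* + e ℤ.≤ b ℤ.* + d → frac a d ≤ℚ frac b e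
frac-≤-frac a b {suc d} {suc e} _ _ ae≤bd = ℚP.toℚᵘ-cancel-≤
  (ℚᵘP.≤-respˡ-≃ (ℚᵘP.≃-sym (ℚP.toℚᵘ-fromℚᵘ (ℚᵘ.mkℚᵘ a d)))
    (ℚᵘP.≤-respʳ-≃ (ℚᵘP.≃-sym (ℚP.toℚᵘ-fromℚᵘ (ℚᵘ.mkℚᵘ b e))) (ℚᵘ.*≤* ae≤bd)))

frac-≡-frac⇔ : ∀ a b {d e} → 0 < d → 0 < e → frac a d ≡ frac b e ⇔ a ℤ.* + e ≡ b ℤ.* + d
frac-≡-frac⇔ a b {suc d} {suc e} _ _ =
  mk⇔ cross (λ ae≡bd → ℚP.fromℚᵘ-cong {ℚᵘ.mkℚᵘ a d} {ℚᵘ.mkℚᵘ b e} (ℚᵘ.*≡* ae≡bd))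
  where
  cross : frac a (suc d) ≡ frac b (suc e) → a ℤ.* + suc e ≡ b ℤ.* + suc d
  cross eq with ℚP.fromℚᵘ-injective {ℚᵘ.mkℚᵘ a d} {ℚᵘ.mkℚᵘ b e} eq
  ... | ℚᵘ.*≡* ae≡bd = ae≡bd

private
  [1+m-n]*e≡e*[1+m]-e*n : ∀ m n e → (+ 1 ℤ.+ + m ℤ.- + n) ℤ.* + e ≡ + (e * suc m) ℤ.- + (e * n)
  [1+m-n]*e≡e*[1+m]-e*n m n e = begin
    (+ 1 ℤ.+ + m ℤ.- + n) ℤ.* + e     ≡⟨ distrib (+ 1) (+ m) (+ n) (+ e) ⟩
    + e ℤ.* + suc m ℤ.- + e ℤ.* + n   ≡⟨ cong₂ ℤ._-_ (ℤP.pos-* e (suc m)) (ℤP.pos-* e n) ⟨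
    + (e * suc m) ℤ.- + (e * n)       ∎
    where
    open ≡-Reasoning
    distrib : ∀ a b c x → (a ℤ.+ b ℤ.- c) ℤ.* x ≡ x ℤ.* (a ℤ.+ b) ℤ.- x ℤ.* c
    distrib = ℤRing.solve-∀

  k*d≡[k*d+c]-c : ∀ k d c → + k ℤ.* + d ≡ + (k * d + c) ℤ.- + c
  k*d≡[k*d+c]-c k d c = begin
    + k ℤ.* + d                 ≡⟨ ℤP.pos-* k d ⟨
    + (k * d)                   ≡⟨ add-sub (+ (k * d)) (+ c) ⟩
    + (k * d) ℤ.+ + c ℤ.- + c   ≡⟨ cong (ℤ._- + c) (ℤP.pos-+ (k * d) c) ⟨
    + (k * d + c) ℤ.- + c       ∎
    where
    open ≡-Reasoning
    add-sub : ∀ x y → x ≡ x ℤ.+ y ℤ.- y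
    add-sub = ℤRing.solve-∀

  +a-+c≡+b-+c⇒a≡b : ∀ {a b} c → + a ℤ.- + c ≡ + b ℤ.- + c → a ≡ b
  +a-+c≡+b-+c⇒a≡b {a} {b} c eq = ℤP.+-injective (begin
    + a                   ≡⟨ sub-add (+ a) (+ c) ⟩
    + a ℤ.- + c ℤ.+ + c   ≡⟨ cong (ℤ._+ + c) eq ⟩
    + b ℤ.- + c ℤ.+ + c   ≡⟨ sub-add (+ b) (+ c) ⟨
    + b                   ∎)
    where
    open ≡-Reasoning
    sub-add : ∀ x y → x ≡ x ℤ.- y ℤ.+ y
    sub-add = ℤRing.solve-∀

1+m-n-frac-≤ : ∀ m n k {d e} → 0 < d → 0 < e → e * suc m ≤ k * d + e * n →
               frac (+ 1 ℤ.+ + m ℤ.- + n) d ≤ℚ frac (+ k) e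
1+m-n-frac-≤ m n k {d} {e} 0<d 0<e ineq = frac-≤-frac _ _ 0<d 0<e (begin
  (+ 1 ℤ.+ + m ℤ.- + n) ℤ.* + e     ≡⟨ [1+m-n]*e≡e*[1+m]-e*n m n e ⟩
  + (e * suc m) ℤ.- + (e * n)       ≤⟨ ℤP.+-monoˡ-≤ (ℤ.- + (e * n)) (+≤+ ineq) ⟩
  + (k * d + e * n) ℤ.- + (e * n)   ≡⟨ k*d≡[k*d+c]-c k d (e * n) ⟨
  + k ℤ.* + d                       ∎)
  where open ℤP.≤-Reasoning

1+m-n-frac-≡⇔ : ∀ m n k {d e} → 0 < d → 0 < e →
                frac (+ 1 ℤ.+ + m ℤ.- + n) d ≡ frac (+ k) e ⇔ e * suc m ≡ k * d + e * n
1+m-n-frac-≡⇔ m n k {d} {e} 0<d 0<e = mk⇔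
  (λ α≡ → +a-+c≡+b-+c⇒a≡b (e * n) (begin
    + (e * suc m) ℤ.- + (e * n)       ≡⟨ [1+m-n]*e≡e*[1+m]-e*n m n e ⟨
    (+ 1 ℤ.+ + m ℤ.- + n) ℤ.* + e     ≡⟨ to α≡ ⟩
    + k ℤ.* + d                       ≡⟨ k*d≡[k*d+c]-c k d (e * n) ⟩
    + (k * d + e * n) ℤ.- + (e * n)   ∎))
  (λ eq → from (begin
    (+ 1 ℤ.+ + m ℤ.- + n) ℤ.* + e     ≡⟨ [1+m-n]*e≡e*[1+m]-e*n m n e ⟩
    + (e * suc m) ℤ.- + (e * n)       ≡⟨ cong (λ x → + x ℤ.- + (e * n)) eq ⟩
    + (k * d + e * n) ℤ.- + (e * n)   ≡⟨ k*d≡[k*d+c]-c k d (e * n) ⟨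
    + k ℤ.* + d                       ∎))
  where
  open Equivalence (frac-≡-frac⇔ (+ 1 ℤ.+ + m ℤ.- + n) (+ k) 0<d 0<e)
  open ≡-Reasoning

x≡x+y⇔y≡0 : ∀ x {y} → x ≡ x + y ⇔ y ≡ 0
x≡x+y⇔y≡0 x = mk⇔ (λ eq → sym (+-cancelˡ-≡ x 0 _ (trans (+-identityʳ x) eq)))
                  (λ { refl → sym (+-identityʳ x) })

m*n≡0⇒n≡0 : ∀ {m n} → 0 < m → m * n ≡ 0 → n ≡ 0
m*n≡0⇒n≡0 {m} {n} 0<m eq = *-cancelˡ-≡ n 0 m {{>-nonZero 0<m}} (trans eq (sym (*-zeroʳ m)))

[o∸n]+[n∸m]≡o∸m : ∀ {m n o} → m ≤ n → n ≤ o → (o ∸ n) + (n ∸ m) ≡ o ∸ m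
[o∸n]+[n∸m]≡o∸m {m} {n} {o} m≤n n≤o =
  trans (sym (+-∸-assoc (o ∸ n) m≤n)) (cong (_∸ m) (m∸n+n≡m n≤o))

bernoulli : ∀ q m → 1 + m * q ≤ suc q ^ m
bernoulli⁺ : ∀ q m → 1 + suc m * q + q * (m * q) ≤ suc q ^ suc m

bernoulli q zero    = ≤-refl
bernoulli q (suc m) = ≤-trans (m≤m+n _ _) (bernoulli⁺ q m)

bernoulli⁺ q m = ≤-trans (≤-reflexive (expand q m)) (*-monoʳ-≤ (suc q) (bernoulli q m))
  where
  expand : ∀ q m → 1 + (1 + m) * q + q * (m * q) ≡ (1 + q) * (1 + m * q)
  expand = solve-∀

bernoulli-strict : ∀ q m → 0 < q → 2 ≤ m → 1 + m * q < suc q ^ m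
bernoulli-strict q (suc m) 0<q (s≤s 0<m) =
  <-≤-trans (m<m+n _ (*-mono-≤ 0<q (*-mono-≤ 0<m 0<q))) (bernoulli⁺ q m)

slack : ℕ → ℕ → ℕ
slack q j = q ∸ j % suc q

module _ (q j : ℕ) where
  private
    division : j ≡ j % suc q + j / suc q * suc q
    division = m≡m%n+[m/n]*n j (suc q)

    slack+digit : slack q j + j % suc q ≡ q
    slack+digit = m∸n+n≡m (s≤s⁻¹ (m%n<n j (suc q)))

  slack-law : j + 1 + slack q j ≡ suc q * suc (j / suc q)
  slack-law = begin
    j + 1 + slack q j                 ≡⟨ cong (λ i → i + 1 + slack q j) division ⟩
    ρ + f * suc q + 1 + slack q j     ≡⟨ shuffle ρ f q (slack q j) ⟩
    (slack q j + ρ) + 1 + f * suc q   ≡⟨ cong (λ x → x + 1 + f * suc q) slack+digit ⟩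
    q + 1 + f * suc q                 ≡⟨ collect q f ⟩
    suc q * suc f                     ∎
    where
    open ≡-Reasoning
    ρ = j % suc q
    f = j / suc q
    shuffle : ∀ ρ f q E → ρ + f * (1 + q) + 1 + E ≡ (E + ρ) + 1 + f * (1 + q)
    shuffle = solve-∀
    collect : ∀ q f → q + 1 + f * (1 + q) ≡ (1 + q) * (1 + f)
    collect = solve-∀

  slack-digit : q * (j + 1) + suc q * (j / suc q) ≡ slack q j + suc q * j
  slack-digit = begin
    q * (j + 1) + suc q * f
      ≡⟨ cong (λ i → q * (i + 1) + suc q * f) division ⟩
    q * (ρ + f * suc q + 1) + suc q * f
      ≡⟨ expand q ρ f ⟩
    q * ρ + f * suc q * suc q + q
      ≡⟨ cong (λ x → q * ρ + f * suc q * suc q + x) slack+digit ⟨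
    q * ρ + f * suc q * suc q + (slack q j + ρ)
      ≡⟨ regroup q ρ f (slack q j) ⟩
    slack q j + suc q * (ρ + f * suc q)
      ≡⟨ cong (λ i → slack q j + suc q * i) division ⟨
    slack q j + suc q * j
      ∎
    where
    open ≡-Reasoning
    ρ = j % suc q
    f = j / suc q
    expand : ∀ q ρ f → q * (ρ + f * (1 + q) + 1) + (1 + q) * f ≡ q * ρ + f * (1 + q) * (1 + q) + q
    expand = solve-∀
    regroup : ∀ q ρ f E → q * ρ + f * (1 + q) * (1 + q) + (E + ρ) ≡ E + (1 + q) * (ρ + f * (1 + q))
    regroup = solve-∀

descent : ∀ t (rs : Fin (2 + t) → ℕ) → (∀ i → rs (suc i) < rs (inject₁ i)) →
          suc t + rs (fromℕ (suc t)) ≤ rs zero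
descent zero    rs dec = dec zero
descent (suc t) rs dec = ≤-trans (s≤s (descent t (rs ∘ suc) (dec ∘ suc))) (dec zero)

module Staircase {p : ℕ} (pp : Prime p) where
  private instance
    p≢0 : NonZero p
    p≢0 = prime⇒nonZero pp

  1<p : 1 < p
  1<p = nonTrivial⇒n>1 p {{prime⇒nonTrivial pp}}

  Σδj Σδj/p : ∀ {a} → Datum p a pp → ℕ
  Σδj   d = Σ (Datum.s d) (λ i → Datum.δ d i * Datum.js d i)
  Σδj/p d = Σ (Datum.s d) (λ i → Datum.δ d i * ⌊ Datum.js d i / p ⌋ pp)

  tail : ∀ {a} (d : Datum p a pp) → 2 ≤ Datum.s d → Datum p (Datum.rs d (suc zero)) pp
  tail record { t = zero } (s≤s ())
  tail record { t = suc t ; rs = rs ; js = js ; rs-dec = rs-dec ; js-dec = js-dec ; js-pos = js-pos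
              ; js-ndv = js-ndv } _ =
    record { t = t ; rs = rs ∘ suc ; js = js ∘ suc ; rs-top = refl ; rs-dec = rs-dec ∘ suc
           ; js-dec = λ i k i<k → js-dec (suc i) (suc k) (s≤s i<k) ; js-pos = js-pos ∘ suc
           ; js-ndv = js-ndv ∘ suc }

  single : ∀ {a b} j → b < a → 0 < j → j < p → Datum p a pp
  single {a} {b} j b<a 0<j j<p = record
    { t = 0 ; rs = λ { zero → a ; (suc _) → b } ; js = λ _ → j ; rs-top = refl ; rs-dec = λ { zero → b<a }
    ; js-dec = λ { zero zero () } ; js-pos = λ _ → 0<j ; js-ndv = λ _ → >⇒∤ {{>-nonZero 0<j}} j<p }

  s+rlast≤top : ∀ {a} (d : Datum p a pp) → Datum.s d + Datum.rlast d ≤ a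
  s+rlast≤top d = subst (Datum.s d + Datum.rlast d ≤_) (Datum.rs-top d)
                        (descent (Datum.t d) (Datum.rs d) (Datum.rs-dec d))

  s≤u : ∀ {a} (d : Datum p a pp) → Datum.s d ≤ Datum.u d
  s≤u d = m+n≤o⇒m≤o∸n (Datum.s d) (s+rlast≤top d)

  2≤u⇒2+rlast≤top : ∀ {a} (d : Datum p a pp) → 2 ≤ Datum.u d → 2 + Datum.rlast d ≤ a
  2≤u⇒2+rlast≤top d = m≤o∸n⇒m+n≤o 2 (m+n≤o⇒n≤o (Datum.s d) (s+rlast≤top d))

  0<denom : ∀ {a} (d : Datum p a pp) → 0 < Datum.denom d
  0<denom record { js = js ; rs-dec = rs-dec } = ≤-trans
    (*-mono-≤ (m≤n+m 1 (js zero)) (m<n⇒0<n∸m (^-monoʳ-< p 1<p (rs-dec zero))))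
    (m≤m+n _ _)

  one-step-cross : ∀ {a} (d : Datum p a pp) → Datum.u d ≡ 1 →
    1 * Datum.denom d + (p ^ a ∸ p ^ (a ∸ 1)) * Σδj/p d
      ≡ (p ^ a ∸ p ^ (a ∸ 1)) * suc (Σδj d) + (p ^ a ∸ p ^ (a ∸ 1)) * (Datum.js d zero / p)
  one-step-cross d@record { t = suc _ } u≡1 =
    contradiction (subst (2 ≤_) u≡1 (≤-trans (s≤s (s≤s z≤n)) (s≤u d))) λ { (s≤s ()) }
  one-step-cross record { t = zero ; rs = rs ; js = js ; rs-top = refl ; rs-dec = rs-dec } u≡1 =
    shape (js zero) u≡1 (cong (λ b → p ^ rs zero ∸ p ^ b) (sym r₀∸1≡r₁))
    where
    r₀∸1≡r₁ : rs zero ∸ 1 ≡ rs (suc zero)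
    r₀∸1≡r₁ = trans (cong (rs zero ∸_) (sym u≡1)) (m∸[m∸n]≡n (<⇒≤ (rs-dec zero)))
    expand : ∀ j f Z → 1 * ((j + 1) * Z + 0) + Z * (1 * f + 0) ≡ Z * (1 + (1 * j + 0)) + Z * f
    expand = solve-∀
    shape : ∀ {δ Δ Z} j → δ ≡ 1 → Δ ≡ Z →
            1 * ((j + 1) * Δ + 0) + Z * (δ * (j / p) + 0) ≡ Z * suc (δ * j + 0) + Z * (j / p)
    shape j refl refl = expand j (j / p) _

  0<pᵃ-pᵃ⁻¹ : ∀ {a} (d : Datum p a pp) → Datum.u d ≡ 1 → 0 < p ^ a ∸ p ^ (a ∸ 1)
  0<pᵃ-pᵃ⁻¹ {zero}  d u≡1 = contradiction (trans (sym (0∸n≡0 (Datum.rlast d))) u≡1) λ ()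
  0<pᵃ-pᵃ⁻¹ {suc a} _ _   = m<n⇒0<n∸m (^-monoʳ-< p 1<p (n<1+n a))

  u≡1⇒α≤1/[pᵃ-pᵃ⁻¹] : ∀ {a} (d : Datum p a pp) → Datum.u d ≡ 1 →
                       Datum.α d ≤ℚ frac (+ 1) (p ^ a ∸ p ^ (a ∸ 1))
  u≡1⇒α≤1/[pᵃ-pᵃ⁻¹] d u≡1 = 1+m-n-frac-≤ (Σδj d) (Σδj/p d) 1 (0<denom d) (0<pᵃ-pᵃ⁻¹ d u≡1)
    (≤-trans (m≤m+n _ _) (≤-reflexive (sym (one-step-cross d u≡1))))

  u≡1⇒[α≡1/[pᵃ-pᵃ⁻¹]⇔j<p] : ∀ {a} (d : Datum p a pp) → Datum.u d ≡ 1 →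
    Datum.α d ≡ frac (+ 1) (p ^ a ∸ p ^ (a ∸ 1)) ⇔ (1 ≤ Datum.js d zero × Datum.js d zero < p)
  u≡1⇒[α≡1/[pᵃ-pᵃ⁻¹]⇔j<p] {a} d u≡1 = mk⇔
    (λ α≡ → Datum.js-pos d zero , m/n≡0⇒m<n (⌊j/p⌋≡0 (to α≡)))
    (λ (_ , j<p) → from (trans (Equivalence.from (x≡x+y⇔y≡0 _) (Z*⌊j/p⌋≡0 (m<n⇒m/n≡0 j<p)))
                               (sym (one-step-cross d u≡1))))
    where
    open Equivalence (1+m-n-frac-≡⇔ (Σδj d) (Σδj/p d) 1 (0<denom d) (0<pᵃ-pᵃ⁻¹ d u≡1))
    Z = p ^ a ∸ p ^ (a ∸ 1)
    Z*⌊j/p⌋≡0 : Datum.js d zero / p ≡ 0 → Z * (Datum.js d zero / p) ≡ 0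
    Z*⌊j/p⌋≡0 f≡0 = trans (cong (Z *_) f≡0) (*-zeroʳ Z)
    ⌊j/p⌋≡0 : Z * suc (Σδj d) ≡ 1 * Datum.denom d + Z * Σδj/p d → Datum.js d zero / p ≡ 0
    ⌊j/p⌋≡0 eq = m*n≡0⇒n≡0 (0<pᵃ-pᵃ⁻¹ d u≡1) (Equivalence.to (x≡x+y⇔y≡0 _) (trans eq (one-step-cross d u≡1)))

module Gap (q₀ r : ℕ) where
  q p Q K M : ℕ
  q = suc q₀
  p = suc q
  Q = p ^ r ∸ 1
  K = 1 + r * q
  M = p * Q

  gap : ℕ → ℕ
  gap b = K * (p ^ r ∸ p ^ b) ∸ q * Q * (r ∸ b)

  0<Q : 0 < r → 0 < Q
  0<Q 0<r = m<n⇒0<n∸m (^-monoʳ-< p (s≤s (s≤s z≤n)) 0<r)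

  0<M : 0 < r → 0 < M
  0<M 0<r = *-mono-≤ {1} {p} z<s (0<Q 0<r)

  private
    positive-power : ∀ b → ∃ λ x → p ^ b ≡ suc x
    positive-power b = let x , 1+x≡pᵇ = m≤n⇒∃[o]m+o≡n (m^n>0 p b) in x , sym 1+x≡pᵇ

    bernoulli-power : ∀ m → ∃ λ s → p ^ m ≡ suc (m * q + s)
    bernoulli-power m = let s , eq = m≤n⇒∃[o]m+o≡n (bernoulli q m) in s , sym eq

    pʳ≡ : ∀ b m {x y} → b + m ≡ r → p ^ b ≡ suc x → p ^ m ≡ suc y → p ^ r ≡ suc x * suc y
    pʳ≡ b m b+m≡r eX eY = trans (cong (p ^_) (sym b+m≡r)) (trans (^-distribˡ-+-* p b m) (cong₂ _*_ eX eY))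

  Q-closed : ∀ b m {x y} → b + m ≡ r → p ^ b ≡ suc x → p ^ m ≡ suc y → Q ≡ y + x * suc y
  Q-closed b m b+m≡r eX eY = cong (_∸ 1) (pʳ≡ b m b+m≡r eX eY)

  K*[pʳ-pᵇ]-closed : ∀ b m {x s} → b + m ≡ r → p ^ b ≡ suc x → p ^ m ≡ suc (m * q + s) →
    K * (p ^ r ∸ p ^ b) ≡ q * Q * m + (m * q + suc x * s + b * q * suc x * (m * q + s))
  K*[pʳ-pᵇ]-closed b m {x} {s} b+m≡r eX eY = begin
    K * (p ^ r ∸ p ^ b)               ≡⟨ cong₂ _*_ (cong (λ n → 1 + n * q) (sym b+m≡r)) pʳ-pᵇ≡ ⟩
    (1 + (b + m) * q) * (suc x * y)   ≡⟨ expand b m q x s ⟩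
    q * (y + x * suc y) * m + G       ≡⟨ cong (λ Q′ → q * Q′ * m + G) (Q-closed b m b+m≡r eX eY) ⟨
    q * Q * m + G                     ∎
    where
    open ≡-Reasoning
    y = m * q + s
    G = m * q + suc x * s + b * q * suc x * y
    pʳ-pᵇ≡ : p ^ r ∸ p ^ b ≡ suc x * y
    pʳ-pᵇ≡ = begin
      p ^ r ∸ p ^ b               ≡⟨ cong₂ _∸_ (pʳ≡ b m b+m≡r eX eY) eX ⟩
      suc x * suc y ∸ suc x       ≡⟨ cong (_∸ suc x) (*-suc (suc x) y) ⟩
      suc x + suc x * y ∸ suc x   ≡⟨ m+n∸m≡n (suc x) _ ⟩
      suc x * y                   ∎
    expand : ∀ b m q x s →
      (1 + (b + m) * q) * ((1 + x) * (m * q + s))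
        ≡ q * ((m * q + s) + x * (1 + (m * q + s))) * m
          + (m * q + (1 + x) * s + b * q * (1 + x) * (m * q + s))
    expand = solve-∀

  gap-closed : ∀ b m {x s} → b + m ≡ r → p ^ b ≡ suc x → p ^ m ≡ suc (m * q + s) →
    gap b ≡ m * q + suc x * s + b * q * suc x * (m * q + s)
  gap-closed b m b+m≡r eX eY = trans
    (cong₂ _∸_ (K*[pʳ-pᵇ]-closed b m b+m≡r eX eY)
               (cong (q * Q *_) (trans (cong (_∸ b) (sym b+m≡r)) (m+n∸m≡n b m))))
    (m+n∸m≡n (q * Q * m) _)

  gap-spec : ∀ {b} → b ≤ r → q * Q * (r ∸ b) + gap b ≡ K * (p ^ r ∸ p ^ b)
  gap-spec {b} b≤r = m+[n∸m]≡n (≤-trans (m≤m+n (q * Q * (r ∸ b)) _)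
    (≤-reflexive (sym (K*[pʳ-pᵇ]-closed b (r ∸ b) (m+[n∸m]≡n b≤r) eX eY))))
    where
    eX = proj₂ (positive-power b)
    eY = proj₂ (bernoulli-power (r ∸ b))

  gap-step : ∀ {a b} → b ≤ a → a ≤ r → q * Q * (a ∸ b) + gap b ≡ gap a + K * (p ^ a ∸ p ^ b)
  gap-step {a} {b} b≤a a≤r = +-cancelˡ-≡ (q * Q * (r ∸ a)) _ _ (begin
    q * Q * (r ∸ a) + (q * Q * (a ∸ b) + gap b)
      ≡⟨ regroup (q * Q) (r ∸ a) (a ∸ b) (gap b) ⟩
    q * Q * (r ∸ a + (a ∸ b)) + gap b
      ≡⟨ cong (λ n → q * Q * n + gap b) ([o∸n]+[n∸m]≡o∸m b≤a a≤r) ⟩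
    q * Q * (r ∸ b) + gap b
      ≡⟨ gap-spec (≤-trans b≤a a≤r) ⟩
    K * (p ^ r ∸ p ^ b)
      ≡⟨ cong (K *_) ([o∸n]+[n∸m]≡o∸m (^-monoʳ-≤ p b≤a) (^-monoʳ-≤ p a≤r)) ⟨
    K * (p ^ r ∸ p ^ a + (p ^ a ∸ p ^ b))
      ≡⟨ *-distribˡ-+ K (p ^ r ∸ p ^ a) (p ^ a ∸ p ^ b) ⟩
    K * (p ^ r ∸ p ^ a) + K * (p ^ a ∸ p ^ b)
      ≡⟨ cong (_+ K * (p ^ a ∸ p ^ b)) (gap-spec a≤r) ⟨
    q * Q * (r ∸ a) + gap a + K * (p ^ a ∸ p ^ b)
      ≡⟨ +-assoc (q * Q * (r ∸ a)) _ _ ⟩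
    q * Q * (r ∸ a) + (gap a + K * (p ^ a ∸ p ^ b))
      ∎)
    where
    open ≡-Reasoning
    regroup : ∀ c x y g → c * x + (c * y + g) ≡ c * (x + y) + g
    regroup = solve-∀

  gap-top : gap r ≡ 0
  gap-top = n≤0⇒n≡0 (≤-trans (m∸n≤m _ (q * Q * (r ∸ r)))
                             (≤-reflexive (trans (cong (K *_) (n∸n≡0 (p ^ r))) (*-zeroʳ K))))

  gap-bottom : gap 0 ≡ Q
  gap-bottom = begin
    gap 0                                     ≡⟨ gap-closed 0 r refl refl eY ⟩
    r * q + 1 * s + 0 * q * 1 * (r * q + s)   ≡⟨ simplify (r * q) s ⟩
    r * q + s + 0 * suc (r * q + s)           ≡⟨ Q-closed 0 r refl refl eY ⟨
    Q                                         ∎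
    where
    open ≡-Reasoning
    s = proj₁ (bernoulli-power r)
    eY = proj₂ (bernoulli-power r)
    simplify : ∀ x s → x + 1 * s + 0 * q * 1 * (x + s) ≡ x + s + 0 * (1 + (x + s))
    simplify = solve-∀

  gap-pos : ∀ {b} → b < r → 0 < gap b
  gap-pos {b} b<r = subst (0 <_) (sym (gap-closed b m (m+[n∸m]≡n (<⇒≤ b<r)) eX eY))
    (≤-trans (*-mono-≤ (m<n⇒0<n∸m b<r) z<s) (≤-trans (m≤m+n (m * q) _) (m≤m+n _ _)))
    where
    m = r ∸ b
    eX = proj₂ (positive-power b)
    eY = proj₂ (bernoulli-power m)

  Q<gap : ∀ {b} → 0 < b → 2 + b ≤ r → Q < gap b
  Q<gap {suc b₀} _ 2+b≤r =
    subst₂ _<_ (sym (Q-closed b m b+m≡r eX eY)) (sym (trans (gap-closed b m b+m≡r eX eY) (split b₀ m q₀ x s₀)))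
      (s≤s (m≤m+n _ _))
    where
    b = suc b₀
    m = r ∸ b
    b+m≡r = m+[n∸m]≡n (≤-trans (m≤n+m b 2) 2+b≤r)
    x = proj₁ (positive-power b)
    eX = proj₂ (positive-power b)
    strict = m≤n⇒∃[o]m+o≡n (bernoulli-strict q m z<s (m+n≤o⇒m≤o∸n 2 2+b≤r))
    s₀ = proj₁ strict
    eY : p ^ m ≡ suc (m * q + suc s₀)
    eY = trans (sym (proj₂ strict)) (cong suc (sym (+-suc (m * q) s₀)))
    split : ∀ b₀ m q₀ x s₀ →
      m * (1 + q₀) + (1 + x) * (1 + s₀) + (1 + b₀) * (1 + q₀) * (1 + x) * (m * (1 + q₀) + (1 + s₀))
        ≡ 1 + ((m * (1 + q₀) + (1 + s₀)) + x * (1 + (m * (1 + q₀) + (1 + s₀)))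
               + (m * (1 + q₀) + (1 + x) * s₀ + (b₀ + q₀ + b₀ * q₀) * (1 + x) * (m * (1 + q₀) + (1 + s₀))))
    split = solve-∀

  Q≤gap : ∀ {b} → 2 + b ≤ r → Q ≤ gap b
  Q≤gap {zero}  _     = ≤-reflexive (sym gap-bottom)
  Q≤gap {suc b} 2+b≤r = <⇒≤ (Q<gap z<s 2+b≤r)

  gap∸Q≡0⇒b≡0 : ∀ {b} → 2 + b ≤ r → gap b ∸ Q ≡ 0 → b ≡ 0
  gap∸Q≡0⇒b≡0 {zero}  _     _       = refl
  gap∸Q≡0⇒b≡0 {suc b} 2+b≤r gap∸Q≡0 = contradiction gap∸Q≡0 (m>n⇒m∸n≢0 (Q<gap z<s 2+b≤r))

  x+w*gap-top≡x : ∀ {a} x w → a ≡ r → x + w * gap a ≡ x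
  x+w*gap-top≡x x w refl =
    trans (cong (λ g → x + w * g) gap-top) (trans (cong (λ y → x + y) (*-zeroʳ w)) (+-identityʳ x))

  segment-identity : ∀ {a b} j → b ≤ a → a ≤ r →
    K * ((j + 1) * (p ^ a ∸ p ^ b)) + M * ((a ∸ b) * (j / p)) + (j + 1) * gap a
      ≡ (j + 1) * gap b + Q * (a ∸ b) * slack q j + M * ((a ∸ b) * j)
  segment-identity {a} {b} j b≤a a≤r = begin
    K * (w * Δ) + M * (δ * f) + w * gap a        ≡⟨ regroup K w Δ M δ f (gap a) ⟩
    w * (gap a + K * Δ) + M * (δ * f)            ≡⟨ cong (λ g → w * g + M * (δ * f)) (gap-step b≤a a≤r) ⟨
    w * (q * Q * δ + gap b) + M * (δ * f)        ≡⟨ distribute w q Q δ (gap b) p f ⟩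
    w * gap b + Q * δ * (q * w + p * f)          ≡⟨ cong (λ n → w * gap b + Q * δ * n) (slack-digit q j) ⟩
    w * gap b + Q * δ * (slack q j + p * j)      ≡⟨ collect w (gap b) Q δ (slack q j) p j ⟩
    w * gap b + Q * δ * slack q j + M * (δ * j)  ∎
    where
    open ≡-Reasoning
    w = j + 1
    Δ = p ^ a ∸ p ^ b
    δ = a ∸ b
    f = j / p
    regroup : ∀ K w Δ M δ f g → K * (w * Δ) + M * (δ * f) + w * g ≡ w * (g + K * Δ) + M * (δ * f)
    regroup = solve-∀
    distribute : ∀ w q Q δ g p f → w * (q * Q * δ + g) + p * Q * (δ * f) ≡ w * g + Q * δ * (q * w + p * f)
    distribute = solve-∀
    collect : ∀ w g Q δ E p j → w * g + Q * δ * (E + p * j) ≡ w * g + Q * δ * E + p * Q * (δ * j)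
    collect = solve-∀

  last-segment : ∀ {g δ} j → Q ≤ g → 1 ≤ δ →
    (j + 1) * g + Q * δ * slack q j ≡ M * suc (j / p) + ((j + 1) * (g ∸ Q) + Q * (δ ∸ 1) * slack q j)
  last-segment {g} {δ} j Q≤g 1≤δ = begin
    w * g + Q * δ * E
      ≡⟨ cong₂ (λ g′ δ′ → w * g′ + Q * δ′ * E) (m+[n∸m]≡n Q≤g) (m+[n∸m]≡n 1≤δ) ⟨
    w * (Q + (g ∸ Q)) + Q * (1 + (δ ∸ 1)) * E
      ≡⟨ regroup w Q (g ∸ Q) (δ ∸ 1) E ⟩
    Q * (w + E) + X
      ≡⟨ cong (λ n → Q * n + X) (slack-law q j) ⟩
    Q * (p * suc f) + X
      ≡⟨ cong (_+ X) (rotate Q p (suc f)) ⟩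
    M * suc f + X
      ∎
    where
    open ≡-Reasoning
    w = j + 1
    E = slack q j
    f = j / p
    X = w * (g ∸ Q) + Q * (δ ∸ 1) * E
    regroup : ∀ w Q e d E → w * (Q + e) + Q * (1 + d) * E ≡ Q * (w + E) + (w * e + Q * d * E)
    regroup = solve-∀
    rotate : ∀ Q p n → Q * (p * n) ≡ p * Q * n
    rotate = solve-∀

  excess : ℕ → ℕ → ℕ → ℕ
  excess b δ j = M * (j / p) + ((j + 1) * (gap b ∸ Q) + Q * (δ ∸ 1) * slack q j)

  single-segment : ∀ {a b} j → b < a → a ≤ r → 2 + b ≤ r →
    K * ((j + 1) * (p ^ a ∸ p ^ b) + 0) + M * ((a ∸ b) * (j / p) + 0) + (j + 1) * gap a
      ≡ M * suc ((a ∸ b) * j + 0) + excess b (a ∸ b) j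
  single-segment {a} {b} j b<a a≤r 2+b≤r = begin
    K * (w * Δ + 0) + M * (δ * f + 0) + w * gap a
      ≡⟨ cong₂ (λ x y → K * x + M * y + w * gap a) (+-identityʳ _) (+-identityʳ _) ⟩
    K * (w * Δ) + M * (δ * f) + w * gap a
      ≡⟨ segment-identity j (<⇒≤ b<a) a≤r ⟩
    w * gap b + Q * δ * slack q j + M * (δ * j)
      ≡⟨ cong (_+ M * (δ * j)) (last-segment j (Q≤gap 2+b≤r) (m<n⇒0<n∸m b<a)) ⟩
    M * suc f + X + M * (δ * j)
      ≡⟨ regroup M f X (δ * j) ⟩
    M * suc (δ * j + 0) + (M * f + X)
      ∎
    where
    open ≡-Reasoning
    w = j + 1
    Δ = p ^ a ∸ p ^ b
    δ = a ∸ b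
    f = j / p
    X = w * (gap b ∸ Q) + Q * (δ ∸ 1) * slack q j
    regroup : ∀ M f X y → M * (1 + f) + X + M * y ≡ M * (1 + (y + 0)) + (M * f + X)
    regroup = solve-∀

  excess≡0⇒ : ∀ {b δ} j → 2 ≤ δ → 2 + b ≤ r → excess b δ j ≡ 0 → b ≡ 0 × j ≡ q
  excess≡0⇒ {b} {δ} j 2≤δ 2+b≤r excess≡0 = b≡0 , j≡q
    where
    0<r = ≤-trans (s≤s z≤n) 2+b≤r
    rest≡0 = m+n≡0⇒n≡0 (M * (j / p)) excess≡0
    ⌊j/p⌋≡0 : j / p ≡ 0
    ⌊j/p⌋≡0 = m*n≡0⇒n≡0 (0<M 0<r) (m+n≡0⇒m≡0 _ excess≡0)
    b≡0 : b ≡ 0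
    b≡0 = gap∸Q≡0⇒b≡0 2+b≤r (m*n≡0⇒n≡0 (m≤n+m 1 j) (m+n≡0⇒m≡0 _ rest≡0))
    slack≡0 : slack q j ≡ 0
    slack≡0 = m*n≡0⇒n≡0 (*-mono-≤ (0<Q 0<r) (m+n≤o⇒m≤o∸n 1 2≤δ)) (m+n≡0⇒n≡0 _ rest≡0)
    j≡q : j ≡ q
    j≡q = +-cancelʳ-≡ 1 j q (begin
      j + 1               ≡⟨ +-identityʳ (j + 1) ⟨
      j + 1 + 0           ≡⟨ cong (λ E → j + 1 + E) slack≡0 ⟨
      j + 1 + slack q j   ≡⟨ slack-law q j ⟩
      p * suc (j / p)     ≡⟨ cong (λ f → p * suc f) ⌊j/p⌋≡0 ⟩
      p * 1               ≡⟨ *-identityʳ p ⟩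
      p                   ≡⟨ +-comm 1 q ⟩
      q + 1               ∎)
      where open ≡-Reasoning

  module _ (pp : Prime p) where
    open Staircase pp

    -- The index t only makes the recursion on the number of steps structural.
    tail-bound : ∀ {a t} (d : Datum p a pp) → Datum.t d ≡ t → a ≤ r → 2 + Datum.rlast d ≤ r →
      M * suc (Σδj d) ≤ K * Datum.denom d + M * Σδj/p d + (Datum.js d zero + 1) * gap a
    tail-bound-strict : ∀ {a t} (d : Datum p a pp) → Datum.t d ≡ suc t → a ≤ r → 2 + Datum.rlast d ≤ r →
      M * suc (Σδj d) < K * Datum.denom d + M * Σδj/p d + (Datum.js d zero + 1) * gap a

    tail-bound record { t = zero ; js = js ; rs-top = refl ; rs-dec = rs-dec } refl a≤r 2+rlast≤r =
      ≤-trans (m≤m+n _ _) (≤-reflexive (sym (single-segment (js zero) (rs-dec zero) a≤r 2+rlast≤r)))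
    tail-bound {t = suc t} d@record { t = suc _ } refl a≤r 2+rlast≤r =
      <⇒≤ (tail-bound-strict {t = t} d refl a≤r 2+rlast≤r)

    tail-bound-strict {t = t} d@record { t = suc _ ; rs = rs ; js = js ; rs-top = refl ; rs-dec = rs-dec
                                       ; js-dec = js-dec } refl a≤r 2+rlast≤r = begin-strict
      M * suc (δ * j₀ + S′)
        ≡⟨ split M (δ * j₀) S′ ⟩
      M * suc S′ + M * (δ * j₀)
        ≤⟨ +-monoˡ-≤ (M * (δ * j₀)) (tail-bound {t = t} d′ refl (<⇒≤ b<r) 2+rlast≤r) ⟩
      X′ + w₁ * gap b + M * (δ * j₀)
        <⟨ +-monoˡ-< (M * (δ * j₀)) (+-monoʳ-< X′ (*-monoˡ-< (gap b) {{>-nonZero (gap-pos b<r)}} w₁<w₀)) ⟩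
      X′ + w₀ * gap b + M * (δ * j₀)
        ≤⟨ +-monoˡ-≤ (M * (δ * j₀)) (m≤m+n (X′ + w₀ * gap b) (Q * δ * slack q j₀)) ⟩
      X′ + w₀ * gap b + Q * δ * slack q j₀ + M * (δ * j₀)
        ≡⟨ assoc X′ (w₀ * gap b) (Q * δ * slack q j₀) (M * (δ * j₀)) ⟩
      X′ + (w₀ * gap b + Q * δ * slack q j₀ + M * (δ * j₀))
        ≡⟨ cong (λ y → X′ + y) (segment-identity j₀ (<⇒≤ (rs-dec zero)) a≤r) ⟨
      X′ + (K * (w₀ * Δ) + M * (δ * (j₀ / p)) + w₀ * gap a)
        ≡⟨ regroup K w₀ Δ D′ M δ (j₀ / p) S₂′ (w₀ * gap a) ⟩
      K * (w₀ * Δ + D′) + M * (δ * (j₀ / p) + S₂′) + w₀ * gap a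
        ∎
      where
      open ≤-Reasoning
      d′ = tail d (s≤s (s≤s z≤n))
      S′ = Σδj d′
      S₂′ = Σδj/p d′
      D′ = Datum.denom d′
      X′ = K * D′ + M * S₂′
      a = rs zero
      b = rs (suc zero)
      j₀ = js zero
      w₀ = js zero + 1
      w₁ = js (suc zero) + 1
      δ = a ∸ b
      Δ = p ^ a ∸ p ^ b
      b<r = <-≤-trans (rs-dec zero) a≤r
      w₁<w₀ = +-monoˡ-< 1 (js-dec zero (suc zero) z<s)
      split : ∀ M x y → M * (1 + (x + y)) ≡ M * (1 + y) + M * x
      split = solve-∀
      assoc : ∀ x a b c → x + a + b + c ≡ x + (a + b + c)
      assoc = solve-∀
      regroup : ∀ K w Δ D M δ f S g →
        K * D + M * S + (K * (w * Δ) + M * (δ * f) + g) ≡ K * (w * Δ + D) + M * (δ * f + S) + g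
      regroup = solve-∀

    top-bound : (d : Datum p r pp) → 2 ≤ Datum.u d → M * suc (Σδj d) ≤ K * Datum.denom d + M * Σδj/p d
    top-bound d 2≤u = subst (M * suc (Σδj d) ≤_) (x+w*gap-top≡x _ (Datum.js d zero + 1) refl)
      (tail-bound d refl ≤-refl (2≤u⇒2+rlast≤top d 2≤u))

    2≤u⇒α≤K/M : (d : Datum p r pp) → 2 ≤ Datum.u d → Datum.α d ≤ℚ frac (+ K) M
    2≤u⇒α≤K/M d 2≤u = 1+m-n-frac-≤ (Σδj d) (Σδj/p d) K (0<denom d)
      (0<M (≤-trans (s≤s z≤n) (2≤u⇒2+rlast≤top d 2≤u))) (top-bound d 2≤u)

    tight⇒extremal : (d : Datum p r pp) → 2 ≤ Datum.u d →
      M * suc (Σδj d) ≡ K * Datum.denom d + M * Σδj/p d →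
      Datum.u d ≡ r × Datum.s d ≡ 1 × Datum.js d zero ≡ q
    tight⇒extremal d@record { t = suc _ } 2≤u tight = contradiction
      (subst (M * suc (Σδj d) <_) (x+w*gap-top≡x _ (Datum.js d zero + 1) refl)
             (tail-bound-strict d refl ≤-refl (2≤u⇒2+rlast≤top d 2≤u)))
      (<-irrefl tight)
    tight⇒extremal d@record { t = zero ; rs = rs ; js = js ; rs-top = top ; rs-dec = rs-dec } 2≤u tight =
      cong (r ∸_) (proj₁ extremal) , refl , proj₂ extremal
      where
      b = rs (suc zero)
      δ = rs zero ∸ b
      j = js zero
      2+b≤r = 2≤u⇒2+rlast≤top d 2≤u
      excess≡0 : excess b δ j ≡ 0
      excess≡0 = Equivalence.to (x≡x+y⇔y≡0 _) (begin
        M * suc (Σδj d)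
          ≡⟨ tight ⟩
        K * Datum.denom d + M * Σδj/p d
          ≡⟨ x+w*gap-top≡x _ (j + 1) top ⟨
        K * Datum.denom d + M * Σδj/p d + (j + 1) * gap (rs zero)
          ≡⟨ single-segment j (rs-dec zero) (≤-reflexive top) 2+b≤r ⟩
        M * suc (Σδj d) + excess b δ j
          ∎)
        where open ≡-Reasoning
      extremal = excess≡0⇒ j (subst (λ a → 2 ≤ a ∸ b) (sym top) 2≤u) 2+b≤r excess≡0

    2≤u∧α≡K/M⇒extremal : (d : Datum p r pp) → 2 ≤ Datum.u d → Datum.α d ≡ frac (+ K) M →
      Datum.u d ≡ r × Datum.s d ≡ 1 × Datum.js d zero ≡ q
    2≤u∧α≡K/M⇒extremal d 2≤u = tight⇒extremal d 2≤u ∘ Equivalence.to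
      (1+m-n-frac-≡⇔ (Σδj d) (Σδj/p d) K (0<denom d) (0<M (≤-trans (s≤s z≤n) (2≤u⇒2+rlast≤top d 2≤u))))

    extremal⇒α≡K/M : (d : Datum p r pp) → Datum.u d ≡ r × Datum.s d ≡ 1 × Datum.js d zero ≡ q →
      Datum.α d ≡ frac (+ K) M
    extremal⇒α≡K/M record { t = suc _ } (_ , () , _)
    extremal⇒α≡K/M d@record { t = zero ; rs = rs ; rs-top = top ; rs-dec = rs-dec } (u≡r , _ , j≡q) =
      Equivalence.from (1+m-n-frac-≡⇔ (Σδj d) (Σδj/p d) K (0<denom d) (0<M 0<r)) (cross top b≡0 j≡q)
      where
      0<r = ≤-trans (s≤s z≤n) (≤-trans (s≤u d) (≤-reflexive u≡r))
      b≡0 : rs (suc zero) ≡ 0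
      b≡0 = trans (sym (m∸[m∸n]≡n (subst (rs (suc zero) ≤_) top (<⇒≤ (rs-dec zero)))))
                  (trans (cong (r ∸_) u≡r) (n∸n≡0 r))
      expand : ∀ q₀ r Q → (2 + q₀) * Q * (1 + (r * (1 + q₀) + 0))
                            ≡ (1 + r * (1 + q₀)) * ((1 + q₀ + 1) * Q + 0) + (2 + q₀) * Q * (r * 0 + 0)
      expand = solve-∀
      cross : ∀ {a b j} → a ≡ r → b ≡ 0 → j ≡ q →
        M * suc ((a ∸ b) * j + 0) ≡ K * ((j + 1) * (p ^ a ∸ p ^ b) + 0) + M * ((a ∸ b) * (j / p) + 0)
      cross refl refl refl = trans (expand q₀ r Q)
        (cong (λ f → K * ((q + 1) * Q + 0) + M * (r * f + 0)) (sym (m<n⇒m/n≡0 (n<1+n q))))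

proposition8p19 : (p r : ℕ) (pp : Prime p) → 2 ≤ r →
    -- (1) data with u ≥ 2
    ((∀ (d : Datum p r pp) → 2 ≤ Datum.u d →
        Datum.α d ≤ℚ frac (+ (1 + r * (p ∸ 1))) (p * (p ^ r ∸ 1)))
     × (∃ λ (d : Datum p r pp) → 2 ≤ Datum.u d
        × Datum.α d ≡ frac (+ (1 + r * (p ∸ 1))) (p * (p ^ r ∸ 1)))
     × (∀ (d : Datum p r pp) → 2 ≤ Datum.u d →
        (Datum.α d ≡ frac (+ (1 + r * (p ∸ 1))) (p * (p ^ r ∸ 1))
          ⇔ (Datum.u d ≡ r × Datum.s d ≡ 1 × Datum.js d zero ≡ p ∸ 1))))
    -- (2) data with u = 1
    × ((∀ (d : Datum p r pp) → Datum.u d ≡ 1 →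
        Datum.α d ≤ℚ frac (+ 1) (p ^ r ∸ p ^ (r ∸ 1)))
     × (∃ λ (d : Datum p r pp) → Datum.u d ≡ 1
        × Datum.α d ≡ frac (+ 1) (p ^ r ∸ p ^ (r ∸ 1)))
     × (∀ (d : Datum p r pp) → Datum.u d ≡ 1 →
        (Datum.α d ≡ frac (+ 1) (p ^ r ∸ p ^ (r ∸ 1))
          ⇔ (1 ≤ Datum.js d zero × Datum.js d zero < p))))
proposition8p19 zero           _ pp _   = ⊥-elim (¬prime[0] pp)
proposition8p19 (suc zero)     _ pp _   = ⊥-elim (¬prime[1] pp)
proposition8p19 (suc (suc q₀)) r pp 2≤r =
    ( 2≤u⇒α≤K/M pp
    , (extremal , 2≤r , extremal⇒α≡K/M pp extremal (refl , refl , refl))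
    , λ d 2≤u → mk⇔ (2≤u∧α≡K/M⇒extremal pp d 2≤u) (extremal⇒α≡K/M pp d) )
  , ( u≡1⇒α≤1/[pᵃ-pᵃ⁻¹]
    , (one-step , u≡1 , Equivalence.from (u≡1⇒[α≡1/[pᵃ-pᵃ⁻¹]⇔j<p] one-step u≡1) (≤-refl , 1<p))
    , u≡1⇒[α≡1/[pᵃ-pᵃ⁻¹]⇔j<p] )
  where
  open Gap q₀ r
  open Staircase pp
  1≤r = ≤-trans (s≤s z≤n) 2≤r
  extremal = single {r} {0} q 1≤r z<s (n<1+n q)
  one-step = single {r} {r ∸ 1} 1 (∸-monoʳ-< z<s 1≤r) z<s 1<p
  u≡1 : Datum.u one-step ≡ 1
  u≡1 = m∸[m∸n]≡n 1≤r
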